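{- Let $t\ge 1$ be an integer. For every $\varepsilon>0$ there exist $\delta>0$ and $n_0$ such that the following holds for every $n\ge n_0$. If $\overrightarrow{G}$ is an $n$-vertex oriented graph that does not contain $\overrightarrow{P_3(t)}$ as a subgraph and has at least $n^2/4-\delta n^2$ arcs, then $\overrightarrow{G}$ can be turned into the antidirected $K_{\lfloor n/2\rfloor,\lceil n/2\rceil}$ (on the same vertex set) by deleting, adding and reorienting at most $\varepsilon n^2$ arcs in total.
   Context: An oriented graph is a directed graph with no loops, no multiple arcs and no pair of opposite arcs. $\overrightarrow{P_3(t)}$ is the $t$-blow-up of the directed path on three vertices: it has three disjoint vertex sets $X,Y,Z$, each of size $t$, and arcs $\overrightarrow{xy}$ for all $x\in X,y\in Y$ and $\overrightarrow{yz}$ for all $y\in Y,z\in Z$. The antidirected $K_{\lfloor n/2\rfloor,\lceil n/2\rceil}$ is the complete bipartite graph with parts of sizes $\lfloor n/2\rfloor$ and $\lceil n/2\rceil$ in which all edges are oriented from one part to the other. -}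

module Defs where

open import Data.Nat using (ℕ; zero; suc; _+_; _*_; _<ᵇ_; _/_)
open import Data.Nat.Base using (⌊_/2⌋; ⌈_/2⌉)
open import Data.Bool using (Bool; true; false; _∧_; _∨_; not; if_then_else_)
open import Data.Bool.Properties using () renaming (_≟_ to _≟ᵇ_)
open import Data.Fin using (Fin; toℕ)
open import Data.List using (List; map; allFin)
open import Data.Nat.ListAction using (sum)
open import Data.Product using (Σ; _×_; ∃)
open import Data.Sum using (_⊎_)
open import Relation.Binary.PropositionalEquality using (_≡_; _≢_)
open import Relation.Nullary.Decidable using (⌊_⌋)
open import Function.Definitions using (Injective)

Digraph : ℕ → Set
Digraph n = Fin n → Fin n → Bool

-- Oriented graph: no loops, no pair of opposite arcs
-- (multiple arcs are impossible in this representation).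
IsOriented : ∀ {n} → Digraph n → Set
IsOriented {n} G =
  ((i : Fin n) → G i i ≡ false) ×
  ((i j : Fin n) → G i j ≡ true → G j i ≡ false)

ΣFin : ∀ n → (Fin n → ℕ) → ℕ
ΣFin n f = sum (map f (allFin n))

arcCount : ∀ {n} → Digraph n → ℕ
arcCount {n} G = ΣFin n λ i → ΣFin n λ j → if G i j then 1 else 0

-- G contains the t-blow-up of the directed path on 3 vertices as a subgraph:
-- three pairwise disjoint t-sets X, Y, Z (images of injective maps x, y, z)
-- with all arcs X → Y and Y → Z present.
ContainsP3Blowup : ∀ {n} → ℕ → Digraph n → Set
ContainsP3Blowup {n} t G =
  Σ (Fin t → Fin n) λ x → Σ (Fin t → Fin n) λ y → Σ (Fin t → Fin n) λ z →
    Injective _≡_ _≡_ x × Injective _≡_ _≡_ y × Injective _≡_ _≡_ z ×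
    ((i j : Fin t) → x i ≢ y j) ×
    ((i j : Fin t) → y i ≢ z j) ×
    ((i j : Fin t) → x i ≢ z j) ×
    ((i j : Fin t) → G (x i) (y j) ≡ true) ×
    ((i j : Fin t) → G (y i) (z j) ≡ true)

setSize : ∀ {n} → (Fin n → Bool) → ℕ
setSize {n} S = ΣFin n λ i → if S i then 1 else 0

antidirected : ∀ {n} → (Fin n → Bool) → Digraph n
antidirected S i j = S i ∧ not (S j)

-- Is S a valid source side for an antidirected K_{⌊n/2⌋,⌈n/2⌉} on Fin n:
-- one part has size ⌊n/2⌋, the other ⌈n/2⌉ (either one may be the source side).
BalancedSide : ∀ {n} → (Fin n → Bool) → Set
BalancedSide {n} S = setSize S ≡ ⌊ n /2⌋ ⊎ setSize S ≡ ⌈ n /2⌉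

-- Edit distance between two oriented graphs on the same vertex set: the number
-- of unordered pairs {i,j} on which they differ; each such pair costs exactly one
-- operation (deleting, adding, or reorienting an arc).
pairDiffers : ∀ {n} → Digraph n → Digraph n → Fin n → Fin n → Bool
pairDiffers G H i j = not ⌊ G i j ≟ᵇ H i j ⌋ ∨ not ⌊ G j i ≟ᵇ H j i ⌋

editDistance : ∀ {n} → Digraph n → Digraph n → ℕ
editDistance {n} G H = ΣFin n λ i → ΣFin n λ j →
  if (toℕ i <ᵇ toℕ j) ∧ pairDiffers G H i j then 1 else 0

{-# OPTIONS --safe #-}
module Submission where

-- Fix a large constant A and let S be the set of vertices of in-degree below n/A.  An arc
-- that does not go from S to its complement either enters S (fewer than n²/A such arcs) or
-- leaves a vertex of in-degree at least n/A; the latter are also fewer than n²/A unless they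
-- leave a vertex whose in- and out-degree are both at least n/A.  There are few such vertices:
-- among t(2A)^{2t} of them, repeatedly picking a vertex whose out-neighbourhood contains a
-- 1/(2A)-fraction of the current candidates (an averaging argument) yields t common
-- in-neighbours of a large set, and doing the same backwards inside that set yields a
-- P₃(t)-blow-up.  So G has O(n²/A) arcs outside the antidirected graph S → Sᶜ.  Counting,
-- dist(G, S → Sᶜ) + e(G) = 2·(misplaced arcs) + |S||Sᶜ| and n² = 4|S||Sᶜ| + (|S| − |Sᶜ|)²,
-- so e(G) ≥ n²/4 − n²/A forces both the distance and (|S| − |Sᶜ|)² to be O(n²/A); moving
-- O(n/√A) vertices then balances S exactly.

module Stability where
  open import Defs
  open import Data.Nat
    using (ℕ; zero; suc; _+_; _*_; _∸_; _^_; _≤_; z≤n; s≤s; _≤?_; _<ᵇ_; ∣_-_∣; ⌊_/2⌋; ⌈_/2⌉;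
           NonZero; >-nonZero; >-nonZero⁻¹)
  open import Data.Nat.Properties
  open import Data.Nat.Tactic.RingSolver using (solve-∀)
  open import Algebra.Properties.Semiring.Sum +-*-semiring
    using (sum-syntax; sum-cong-≗; ∑-comm; ∑-distrib-+; *-distribˡ-sum; *-distribʳ-sum)
  open import Data.Nat.ListAction using (sum)
  open import Data.Bool using (Bool; true; false; _∧_; _∨_; not; _xor_; if_then_else_)
  open import Data.Bool.Properties using (∨-identityʳ) renaming (_≟_ to _≟ᵇ_)
  open import Data.Fin as Fin using (Fin; toℕ)
  import Data.Fin.Properties as Fin
  open import Data.List using (map; tabulate)
  open import Data.List.Properties using (map-tabulate)
  open import Data.Vec.Functional using (_∷_)
  open import Data.Product using (Σ; ∃; _×_; _,_; proj₁; proj₂)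
  open import Data.Sum using (inj₁; inj₂)
  open import Function using (_∘_; id)
  open import Function.Definitions using (Injective)
  open import Relation.Binary.PropositionalEquality
  open import Relation.Nullary using (¬_; yes; no; does; contradiction)
  open import Relation.Nullary.Decidable using (⌊_⌋)

  ΣFin≡∑ : ∀ n (f : Fin n → ℕ) → ΣFin n f ≡ ∑[ i < n ] f i
  ΣFin≡∑ zero    f = refl
  ΣFin≡∑ (suc n) f = cong (f Fin.zero +_) (begin
    sum (map f (tabulate Fin.suc))  ≡⟨ cong sum (map-tabulate Fin.suc f) ⟩
    sum (tabulate (f ∘ Fin.suc))    ≡⟨ cong sum (map-tabulate id (f ∘ Fin.suc)) ⟨
    ΣFin n (f ∘ Fin.suc)            ≡⟨ ΣFin≡∑ n (f ∘ Fin.suc) ⟩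
    ∑[ i < n ] f (Fin.suc i)        ∎)
    where open ≡-Reasoning

  ∑-mono-≤ : ∀ {n} {f g : Fin n → ℕ} → (∀ i → f i ≤ g i) → ∑[ i < n ] f i ≤ ∑[ i < n ] g i
  ∑-mono-≤ {zero}  _   = z≤n
  ∑-mono-≤ {suc n} f≤g = +-mono-≤ (f≤g Fin.zero) (∑-mono-≤ (f≤g ∘ Fin.suc))

  ∑-const : ∀ n c → ∑[ i < n ] c ≡ n * c
  ∑-const zero    c = refl
  ∑-const (suc n) c = cong (c +_) (∑-const n c)

  ∑-bound : ∀ {n} c {f : Fin n → ℕ} → (∀ i → f i ≤ c) → ∑[ i < n ] f i ≤ n * c
  ∑-bound {n} c f≤c = ≤-trans (∑-mono-≤ f≤c) (≤-reflexive (∑-const n c))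

  argmax : ∀ {n} (f : Fin (suc n) → ℕ) → ∃ λ x → ∀ y → f y ≤ f x
  argmax {zero} f = Fin.zero , λ { Fin.zero → ≤-refl }
  argmax {suc n} f with argmax (f ∘ Fin.suc)
  ... | x , max with f Fin.zero ≤? f (Fin.suc x)
  ...   | yes f0≤ = Fin.suc x , λ { Fin.zero → f0≤ ; (Fin.suc y) → max y }
  ...   | no  f0≰ = Fin.zero , λ { Fin.zero    → ≤-refl
                               ; (Fin.suc y) → ≤-trans (max y) (<⇒≤ (≰⇒> f0≰)) }

  pigeonhole : ∀ {n} m w (g : Fin (suc n) → ℕ) →
    w * suc n ≤ m * ∑[ x < suc n ] g x → ∃ λ x → w ≤ m * g x
  pigeonhole {n} m w g average with argmax g
  ... | x , max = x , *-cancelʳ-≤ w (m * g x) (suc n) (begin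
    w * suc n              ≤⟨ average ⟩
    m * ∑[ y < suc n ] g y ≤⟨ *-monoʳ-≤ m (∑-bound (g x) max) ⟩
    m * (suc n * g x)      ≡⟨ rearrange m (suc n) (g x) ⟩
    m * g x * suc n        ∎)
    where
    open ≤-Reasoning
    rearrange : ∀ a b c → a * (b * c) ≡ a * c * b
    rearrange = solve-∀

  ⟦_⟧ : Bool → ℕ
  ⟦ b ⟧ = if b then 1 else 0

  ⟦⟧≤1 : ∀ b → ⟦ b ⟧ ≤ 1
  ⟦⟧≤1 true  = ≤-refl
  ⟦⟧≤1 false = z≤n

  ⟦∧⟧ : ∀ a b → ⟦ a ∧ b ⟧ ≡ ⟦ a ⟧ * ⟦ b ⟧
  ⟦∧⟧ true  true  = refl
  ⟦∧⟧ true  false = refl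
  ⟦∧⟧ false b     = refl

  ⟦∧⟧≤ˡ : ∀ a b → ⟦ a ∧ b ⟧ ≤ ⟦ a ⟧
  ⟦∧⟧≤ˡ true  b = ⟦⟧≤1 b
  ⟦∧⟧≤ˡ false b = z≤n

  ⟦⟧+⟦not⟧ : ∀ b → ⟦ b ⟧ + ⟦ not b ⟧ ≡ 1
  ⟦⟧+⟦not⟧ true  = refl
  ⟦⟧+⟦not⟧ false = refl

  size : ∀ {n} → (Fin n → Bool) → ℕ
  size {n} S = ∑[ i < n ] ⟦ S i ⟧

  setSize≡size : ∀ {n} (S : Fin n → Bool) → setSize S ≡ size S
  setSize≡size {n} S = ΣFin≡∑ n _

  size≤n : ∀ {n} (S : Fin n → Bool) → size S ≤ n
  size≤n {n} S = ≤-trans (∑-bound 1 (⟦⟧≤1 ∘ S)) (≤-reflexive (*-identityʳ n))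

  size+size-not : ∀ {n} (S : Fin n → Bool) → size S + size (not ∘ S) ≡ n
  size+size-not {n} S = begin
    size S + size (not ∘ S)           ≡⟨ ∑-distrib-+ (⟦_⟧ ∘ S) (⟦_⟧ ∘ not ∘ S) ⟨
    ∑[ i < n ] (⟦ S i ⟧ + ⟦ not (S i) ⟧) ≡⟨ sum-cong-≗ (⟦⟧+⟦not⟧ ∘ S) ⟩
    ∑[ i < n ] 1                      ≡⟨ ∑-const n 1 ⟩
    n * 1                             ≡⟨ *-identityʳ n ⟩
    n                                 ∎
    where open ≡-Reasoning

  -- does rather than ⌊_⌋: only does commutes definitionally with the suc/suc case of _≟_.
  insert : ∀ {n} → Fin n → (Fin n → Bool) → Fin n → Bool
  insert x S v = S v ∨ does (v Fin.≟ x)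

  size-insert : ∀ {n} (S : Fin n → Bool) x → S x ≡ false → size (insert x S) ≡ suc (size S)
  size-insert {suc n} S Fin.zero S0≡false rewrite S0≡false =
    cong suc (sum-cong-≗ (cong ⟦_⟧ ∘ ∨-identityʳ ∘ S ∘ Fin.suc))
  size-insert {suc n} S (Fin.suc x) Sx≡false = begin
    ⟦ S Fin.zero ∨ false ⟧ + size (insert x (S ∘ Fin.suc))
      ≡⟨ cong₂ _+_ (cong ⟦_⟧ (∨-identityʳ (S Fin.zero))) (size-insert (S ∘ Fin.suc) x Sx≡false) ⟩
    ⟦ S Fin.zero ⟧ + suc (size (S ∘ Fin.suc)) ≡⟨ +-suc ⟦ S Fin.zero ⟧ (size (S ∘ Fin.suc)) ⟩
    suc (size S)                              ∎
    where open ≡-Reasoning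

  indegree outdegree : ∀ {n} → Digraph n → Fin n → ℕ
  indegree  {n} G v = ∑[ u < n ] ⟦ G u v ⟧
  outdegree {n} G v = ∑[ w < n ] ⟦ G v w ⟧

  transpose : ∀ {n} → Digraph n → Digraph n
  transpose G u v = G v u

  outNeighboursIn : ∀ {n} → Digraph n → (Fin n → Bool) → Fin n → Fin n → Bool
  outNeighboursIn G W x v = W v ∧ G x v

  ∑-size-outNeighboursIn : ∀ {n} (G : Digraph n) W →
    ∑[ x < n ] size (outNeighboursIn G W x) ≡ ∑[ v < n ] (⟦ W v ⟧ * indegree G v)
  ∑-size-outNeighboursIn G W = trans (∑-comm (λ x v → ⟦ W v ∧ G x v ⟧)) (sum-cong-≗ λ v →
    trans (sum-cong-≗ λ x → ⟦∧⟧ (W v) (G x v)) (sym (*-distribˡ-sum ⟦ W v ⟧ (λ x → ⟦ G x v ⟧))))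

  size*n≤A*∑size-outNeighboursIn : ∀ {n} (G : Digraph n) A W →
    (∀ v → W v ≡ true → n ≤ A * indegree G v) → size W * n ≤ A * ∑[ x < n ] size (outNeighboursIn G W x)
  size*n≤A*∑size-outNeighboursIn {n} G A W high = begin
    size W * n                                ≡⟨ *-comm (size W) n ⟩
    n * size W                                ≡⟨ *-distribˡ-sum n (⟦_⟧ ∘ W) ⟩
    ∑[ v < n ] (n * ⟦ W v ⟧)                  ≤⟨ ∑-mono-≤ high-indegree ⟩
    ∑[ v < n ] (A * (⟦ W v ⟧ * indegree G v)) ≡⟨ *-distribˡ-sum A (λ v → ⟦ W v ⟧ * indegree G v) ⟨
    A * ∑[ v < n ] (⟦ W v ⟧ * indegree G v)   ≡⟨ cong (A *_) (∑-size-outNeighboursIn G W) ⟨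
    A * ∑[ x < n ] size (outNeighboursIn G W x) ∎
    where
    open ≤-Reasoning
    high-indegree : ∀ v → n * ⟦ W v ⟧ ≤ A * (⟦ W v ⟧ * indegree G v)
    high-indegree v with W v in Wv
    ... | false = ≤-trans (≤-reflexive (*-zeroʳ n)) z≤n
    ... | true  = ≤-trans (≤-reflexive (*-identityʳ n))
                    (≤-trans (high v Wv) (≤-reflexive (cong (A *_) (sym (+-identityʳ _)))))

  ∑≤∑-outside+bound*size : ∀ {n} (X : Fin n → Bool) w {f : Fin n → ℕ} → (∀ x → f x ≤ w) →
    ∑[ x < n ] f x ≤ ∑[ x < n ] (⟦ not (X x) ⟧ * f x) + w * size X
  ∑≤∑-outside+bound*size {n} X w {f} f≤w = begin
    ∑[ x < n ] f x                                   ≤⟨ ∑-mono-≤ split ⟩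
    ∑[ x < n ] (outside x + w * ⟦ X x ⟧)             ≡⟨ ∑-distrib-+ outside (λ x → w * ⟦ X x ⟧) ⟩
    ∑[ x < n ] outside x + ∑[ x < n ] (w * ⟦ X x ⟧) ≡⟨ cong (∑[ x < n ] outside x +_) (*-distribˡ-sum w (⟦_⟧ ∘ X)) ⟨
    ∑[ x < n ] outside x + w * size X                ∎
    where
    open ≤-Reasoning
    outside : Fin n → ℕ
    outside x = ⟦ not (X x) ⟧ * f x
    split : ∀ x → f x ≤ outside x + w * ⟦ X x ⟧
    split x with X x
    ... | true  = ≤-trans (f≤w x) (≤-trans (≤-reflexive (sym (*-identityʳ w))) (m≤n+m _ _))
    ... | false = ≤-trans (≤-reflexive (sym (+-identityʳ (f x)))) (m≤m+n _ _)

  popular-source : ∀ {n} (G : Digraph n) A (X W : Fin n → Bool) →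
    (∀ v → W v ≡ true → n ≤ A * indegree G v) → 2 * A * size X ≤ n → 1 ≤ size W →
    ∃ λ x → X x ≡ false × size W ≤ 2 * A * size (outNeighboursIn G W x)
  popular-source {suc n} G A X W high 2AX≤n W≢∅ =
    x , Xx≡false , subst (λ c → w ≤ 2 * A * c) gx≡cx w≤2Agx
    where
    open ≤-Reasoning
    w = size W
    c g : Fin (suc n) → ℕ
    c x = size (outNeighboursIn G W x)
    g x = ⟦ not (X x) ⟧ * c x
    -- At least wn/A arcs enter W, and at most w·|X| ≤ wn/(2A) of them come from X.
    averaging : w * suc n ≤ 2 * A * ∑[ x < suc n ] g x
    averaging = +-cancelʳ-≤ (w * suc n) _ _ (begin
      w * suc n + w * suc n                        ≡⟨ double (w * suc n) ⟩
      2 * (w * suc n)                              ≤⟨ *-monoʳ-≤ 2 (≤-trans (size*n≤A*∑size-outNeighboursIn G A W high)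
                                                                      (*-monoʳ-≤ A (∑≤∑-outside+bound*size X w c≤w))) ⟩
      2 * (A * (∑[ x < suc n ] g x + w * size X))  ≡⟨ distribute A (∑[ x < suc n ] g x) w (size X) ⟩
      2 * A * ∑[ x < suc n ] g x + 2 * A * size X * w ≤⟨ +-monoʳ-≤ _ (*-monoˡ-≤ w 2AX≤n) ⟩
      2 * A * ∑[ x < suc n ] g x + suc n * w        ≡⟨ cong (2 * A * ∑[ x < suc n ] g x +_) (*-comm (suc n) w) ⟩
      2 * A * ∑[ x < suc n ] g x + w * suc n        ∎)
      where
      c≤w : ∀ x → c x ≤ w
      c≤w x = ∑-mono-≤ λ v → ⟦∧⟧≤ˡ (W v) (G x v)
      double : ∀ a → a + a ≡ 2 * a
      double = solve-∀
      distribute : ∀ a s w k → 2 * (a * (s + w * k)) ≡ 2 * a * s + 2 * a * k * w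
      distribute = solve-∀
    popular = pigeonhole (2 * A) w g averaging
    x = proj₁ popular
    w≤2Agx = proj₂ popular
    Xx≡false : X x ≡ false
    Xx≡false with X x in Xx
    ... | false = refl
    ... | true  = contradiction (begin
      1                             ≤⟨ W≢∅ ⟩
      w                             ≤⟨ w≤2Agx ⟩
      2 * A * (⟦ not (X x) ⟧ * c x) ≡⟨ cong (λ b → 2 * A * (⟦ not b ⟧ * c x)) Xx ⟩
      2 * A * 0                     ≡⟨ *-zeroʳ (2 * A) ⟩
      0                             ∎) λ ()
    gx≡cx : g x ≡ c x
    gx≡cx = trans (cong (λ b → ⟦ not b ⟧ * c x) Xx≡false) (+-identityʳ (c x))

  record Fan {n} (G : Digraph n) (A : ℕ) (W₀ : Fin n → Bool) (k : ℕ) : Set where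
    constructor fan
    field
      sources targets : Fin n → Bool
      sources-size    : size sources ≡ k
      targets⊆W₀      : ∀ v → targets v ≡ true → W₀ v ≡ true
      complete        : ∀ x v → sources x ≡ true → targets v ≡ true → G x v ≡ true
      targets-large   : size W₀ ≤ (2 * A) ^ k * size targets

  0<m≤n*o⇒0<o : ∀ {m} n o → 1 ≤ m → m ≤ n * o → 1 ≤ o
  0<m≤n*o⇒0<o n zero    0<m m≤n*0 =
    contradiction (≤-trans 0<m (≤-trans m≤n*0 (≤-reflexive (*-zeroʳ n)))) λ ()
  0<m≤n*o⇒0<o n (suc o) _   _     = s≤s z≤n

  extend : ∀ {n} {G : Digraph n} {A W₀ k} → (∀ v → W₀ v ≡ true → n ≤ A * indegree G v) →
    2 * A * k ≤ n → 1 ≤ size W₀ → Fan G A W₀ k → Fan G A W₀ (suc k)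
  extend {n} {G} {A} {W₀} {k} high 2Ak≤n W₀≢∅ (fan X W |X|≡k W⊆W₀ X⇒W large)
    with popular-source G A X W (λ v → high v ∘ W⊆W₀ v)
                        (subst (λ m → 2 * A * m ≤ n) (sym |X|≡k) 2Ak≤n)
                        (0<m≤n*o⇒0<o ((2 * A) ^ k) (size W) W₀≢∅ large)
  ... | x , Xx≡false , popular = fan (insert x X) (outNeighboursIn G W x)
    (trans (size-insert X x Xx≡false) (cong suc |X|≡k)) (λ v → W⊆W₀ v ∘ ∧-elimˡ) complete′ large′
    where
    ∧-elimˡ : ∀ {a b} → a ∧ b ≡ true → a ≡ true
    ∧-elimˡ {true} _ = refl
    complete′ : ∀ y v → insert x X y ≡ true → W v ∧ G x v ≡ true → G y v ≡ true
    complete′ y v y∈ v∈ with X y in Xy | y Fin.≟ x | W v in Wv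
    ... | true  | _        | true = X⇒W y v Xy Wv
    ... | false | yes refl | true = v∈
    large′ : size W₀ ≤ (2 * A) ^ suc k * size (outNeighboursIn G W x)
    large′ = begin
      size W₀                          ≤⟨ large ⟩
      (2 * A) ^ k * size W             ≤⟨ *-monoʳ-≤ ((2 * A) ^ k) popular ⟩
      (2 * A) ^ k * (2 * A * size (outNeighboursIn G W x)) ≡⟨ rearrange ((2 * A) ^ k) (2 * A) _ ⟩
      (2 * A) ^ suc k * size (outNeighboursIn G W x) ∎
      where
      open ≤-Reasoning
      rearrange : ∀ p a c → p * (a * c) ≡ a * p * c
      rearrange = solve-∀

  fan-exists : ∀ {n} {G : Digraph n} {A W₀} → (∀ v → W₀ v ≡ true → n ≤ A * indegree G v) →
    1 ≤ size W₀ → ∀ k → 2 * A * k ≤ n → Fan G A W₀ k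
  fan-exists {n} {W₀ = W₀} _ _ zero _ = fan (λ _ → false) W₀
    (trans (∑-const n 0) (*-zeroʳ n)) (λ _ → id) (λ _ _ ()) (≤-reflexive (sym (+-identityʳ _)))
  fan-exists {A = A} high W₀≢∅ (suc k) 2A[1+k]≤n =
    extend high 2Ak≤n W₀≢∅ (fan-exists high W₀≢∅ k 2Ak≤n)
    where 2Ak≤n = ≤-trans (*-monoʳ-≤ (2 * A) (n≤1+n k)) 2A[1+k]≤n

  DistinctElements : ∀ {n} → ℕ → (Fin n → Bool) → Set
  DistinctElements {n} t S =
    Σ (Fin t → Fin n) λ f → Injective _≡_ _≡_ f × (∀ i → S (f i) ≡ true)

  choose : ∀ {n} (S : Fin n → Bool) t → t ≤ size S → DistinctElements t S
  choose S zero _ = (λ ()) , (λ { {()} }) , λ ()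
  choose {suc n} S (suc t) t<|S| with S Fin.zero in S0
  ... | false with choose (S ∘ Fin.suc) (suc t) t<|S|
  ...   | f , f-injective , f∈S = Fin.suc ∘ f , f-injective ∘ Fin.suc-injective , f∈S
  choose {suc n} S (suc t) t<|S| | true with choose (S ∘ Fin.suc) t (≤-pred t<|S|)
  ...   | f , f-injective , f∈S = Fin.zero ∷ Fin.suc ∘ f , injective , chosen∈S
    where
    injective : Injective _≡_ _≡_ (Fin.zero ∷ Fin.suc ∘ f)
    injective {Fin.zero}  {Fin.zero}  _ = refl
    injective {Fin.suc i} {Fin.suc j} e = cong Fin.suc (f-injective (Fin.suc-injective e))
    chosen∈S : ∀ i → S ((Fin.zero ∷ Fin.suc ∘ f) i) ≡ true
    chosen∈S Fin.zero    = S0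
    chosen∈S (Fin.suc i) = f∈S i

  largeIn largeOut large : ∀ {n} → ℕ → Digraph n → Fin n → Bool
  largeIn  {n} A G v = ⌊ n ≤? A * indegree G v ⌋
  largeOut {n} A G v = ⌊ n ≤? A * outdegree G v ⌋
  large A G v = largeIn A G v ∧ largeOut A G v

  large⇒ : ∀ {n} A (G : Digraph n) v → large A G v ≡ true →
    n ≤ A * indegree G v × n ≤ A * outdegree G v
  large⇒ {n} A G v _ with n ≤? A * indegree G v | n ≤? A * outdegree G v
  ... | yes in-large | yes out-large = in-large , out-large

  complete⇒P3Blowup : ∀ {n t} (G : Digraph n) → IsOriented G → (x y z : Fin t → Fin n) →
    Injective _≡_ _≡_ x → Injective _≡_ _≡_ y → Injective _≡_ _≡_ z →
    (∀ i j → G (x i) (y j) ≡ true) → (∀ i j → G (y i) (z j) ≡ true) → ContainsP3Blowup t G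
  complete⇒P3Blowup G (loopless , antisymmetric) x y z x-injective y-injective z-injective x⇒y y⇒z =
    x , y , z , x-injective , y-injective , z-injective , x≢y , y≢z , x≢z , x⇒y , y⇒z
    where
    no-loop : ∀ {u v} → G u v ≡ true → u ≢ v
    no-loop {u} uv refl = contradiction (trans (sym uv) (loopless u)) λ ()
    x≢y : ∀ i j → x i ≢ y j
    x≢y i j = no-loop (x⇒y i j)
    y≢z : ∀ i j → y i ≢ z j
    y≢z i j = no-loop (y⇒z i j)
    x≢z : ∀ i j → x i ≢ z j
    x≢z i j xi≡zj = contradiction (trans (sym (subst (λ u → G u (y i) ≡ true) xi≡zj (x⇒y i i)))
                                          (antisymmetric (y i) (z j) (y⇒z i j))) λ ()

  large⇒P3Blowup : ∀ {n} (G : Digraph n) → IsOriented G → ∀ A t .{{_ : NonZero A}} →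
    1 ≤ t → 2 * A * t ≤ n → t * ((2 * A) ^ t * (2 * A) ^ t) ≤ size (large A G) → ContainsP3Blowup t G
  large⇒P3Blowup G oriented A t t≥1 2At≤n many-large =
    blowup (choose X t (≤-reflexive (sym |X|≡t))) (choose W₂ t t≤|W₂|)
           (choose Z t (≤-reflexive (sym |Z|≡t)))
    where
    p = (2 * A) ^ t
    p>0 : 1 ≤ p
    p>0 = m^n>0 (2 * A) {{m*n≢0 2 A}} t
    M≢∅ : 1 ≤ size (large A G)
    M≢∅ = ≤-trans (*-mono-≤ t≥1 (*-mono-≤ p>0 p>0)) many-large
    open Fan (fan-exists {G = G} {A} (λ v → proj₁ ∘ large⇒ A G v) M≢∅ t 2At≤n)
      renaming (sources to X; targets to W₁; sources-size to |X|≡t; targets⊆W₀ to W₁⊆M;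
                complete to X⇒W₁; targets-large to W₁-large)
    W₁≢∅ : 1 ≤ size W₁
    W₁≢∅ = 0<m≤n*o⇒0<o p (size W₁) M≢∅ W₁-large
    open Fan (fan-exists {G = transpose G} {A} (λ v → proj₂ ∘ large⇒ A G v ∘ W₁⊆M v)
                         W₁≢∅ t 2At≤n)
      renaming (sources to Z; targets to W₂; sources-size to |Z|≡t; targets⊆W₀ to W₂⊆W₁;
                complete to W₂⇒Z; targets-large to W₂-large)
    t≤|W₂| : t ≤ size W₂
    t≤|W₂| = *-cancelʳ-≤ t (size W₂) (p * p) {{>-nonZero (*-mono-≤ p>0 p>0)}} (begin
      t * (p * p)          ≤⟨ many-large ⟩
      size (large A G)     ≤⟨ W₁-large ⟩
      p * size W₁          ≤⟨ *-monoʳ-≤ p W₂-large ⟩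
      p * (p * size W₂)    ≡⟨ rearrange p (size W₂) ⟩
      size W₂ * (p * p)    ∎)
      where
      open ≤-Reasoning
      rearrange : ∀ p s → p * (p * s) ≡ s * (p * p)
      rearrange = solve-∀
    blowup : DistinctElements t X → DistinctElements t W₂ → DistinctElements t Z →
      ContainsP3Blowup t G
    blowup (x , x-injective , x∈X) (y , y-injective , y∈W₂) (z , z-injective , z∈Z) =
      complete⇒P3Blowup G oriented x y z x-injective y-injective z-injective
        (λ i j → X⇒W₁ (x i) (y j) (x∈X i) (W₂⊆W₁ (y j) (y∈W₂ j)))
        (λ i j → W₂⇒Z (z j) (y i) (z∈Z j) (y∈W₂ i))

  ∑²-mono-≤ : ∀ {n} {f g : Fin n → Fin n → ℕ} → (∀ u v → f u v ≤ g u v) →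
    ∑[ u < n ] ∑[ v < n ] f u v ≤ ∑[ u < n ] ∑[ v < n ] g u v
  ∑²-mono-≤ f≤g = ∑-mono-≤ λ u → ∑-mono-≤ (f≤g u)

  ∑²-distrib-+ : ∀ {n} (f g : Fin n → Fin n → ℕ) →
    ∑[ u < n ] ∑[ v < n ] (f u v + g u v) ≡ ∑[ u < n ] ∑[ v < n ] f u v + ∑[ u < n ] ∑[ v < n ] g u v
  ∑²-distrib-+ {n} f g = trans (sum-cong-≗ λ u → ∑-distrib-+ (f u) (g u))
                               (∑-distrib-+ (λ u → ∑[ v < n ] f u v) (λ u → ∑[ v < n ] g u v))

  arcs : ∀ {n} → Digraph n → ℕ
  arcs {n} G = ∑[ u < n ] ∑[ v < n ] ⟦ G u v ⟧

  arcCount≡arcs : ∀ {n} (G : Digraph n) → arcCount G ≡ arcs G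
  arcCount≡arcs {n} G = trans (ΣFin≡∑ n _) (sum-cong-≗ λ u → ΣFin≡∑ n (λ v → ⟦ G u v ⟧))

  arcsNotIn : ∀ {n} → Digraph n → Digraph n → ℕ
  arcsNotIn {n} G H = ∑[ u < n ] ∑[ v < n ] ⟦ G u v ∧ not (H u v) ⟧

  arcsNotIn-antidirected : ∀ {n} (G : Digraph n) S → arcsNotIn G (antidirected S) ≤
    ∑[ v < n ] (⟦ S v ⟧ * indegree G v) + ∑[ u < n ] (⟦ not (S u) ⟧ * outdegree G u)
  arcsNotIn-antidirected {n} G S = begin
    arcsNotIn G (antidirected S)
      ≤⟨ ∑²-mono-≤ (λ u v → into-S-or-out-of-Sᶜ (G u v) (S u) (S v)) ⟩
    ∑[ u < n ] ∑[ v < n ] (⟦ S v ⟧ * ⟦ G u v ⟧ + ⟦ not (S u) ⟧ * ⟦ G u v ⟧)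
      ≡⟨ ∑²-distrib-+ (λ u v → ⟦ S v ⟧ * ⟦ G u v ⟧) (λ u v → ⟦ not (S u) ⟧ * ⟦ G u v ⟧) ⟩
    ∑[ u < n ] ∑[ v < n ] (⟦ S v ⟧ * ⟦ G u v ⟧) + ∑[ u < n ] ∑[ v < n ] (⟦ not (S u) ⟧ * ⟦ G u v ⟧)
      ≡⟨ cong₂ _+_ (trans (∑-comm (λ u v → ⟦ S v ⟧ * ⟦ G u v ⟧))
                          (sum-cong-≗ λ v → sym (*-distribˡ-sum ⟦ S v ⟧ (λ u → ⟦ G u v ⟧))))
                   (sum-cong-≗ λ u → sym (*-distribˡ-sum ⟦ not (S u) ⟧ (λ v → ⟦ G u v ⟧))) ⟩
    ∑[ v < n ] (⟦ S v ⟧ * indegree G v) + ∑[ u < n ] (⟦ not (S u) ⟧ * outdegree G u) ∎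
    where
    open ≤-Reasoning
    into-S-or-out-of-Sᶜ : ∀ g a b → ⟦ g ∧ not (a ∧ not b) ⟧ ≤ ⟦ b ⟧ * ⟦ g ⟧ + ⟦ not a ⟧ * ⟦ g ⟧
    into-S-or-out-of-Sᶜ false a     b     = z≤n
    into-S-or-out-of-Sᶜ true  true  true  = ≤-refl
    into-S-or-out-of-Sᶜ true  true  false = z≤n
    into-S-or-out-of-Sᶜ true  false b     = m≤n+m 1 _

  arcsNotIn-bound : ∀ {n} A (G : Digraph n) →
    A * arcsNotIn G (antidirected (not ∘ largeIn A G)) ≤ 2 * (n * n) + A * n * size (large A G)
  arcsNotIn-bound {n} A G = begin
    A * arcsNotIn G (antidirected S)
      ≤⟨ *-monoʳ-≤ A (arcsNotIn-antidirected G S) ⟩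
    A * (∑[ v < n ] (⟦ S v ⟧ * indegree G v) + ∑[ u < n ] (⟦ not (S u) ⟧ * outdegree G u))
      ≡⟨ *-distribˡ-+ A (∑[ v < n ] (⟦ S v ⟧ * indegree G v)) _ ⟩
    A * ∑[ v < n ] (⟦ S v ⟧ * indegree G v) + A * ∑[ u < n ] (⟦ not (S u) ⟧ * outdegree G u)
      ≡⟨ cong₂ _+_ (*-distribˡ-sum A (λ v → ⟦ S v ⟧ * indegree G v))
                   (*-distribˡ-sum A (λ u → ⟦ not (S u) ⟧ * outdegree G u)) ⟩
    ∑[ v < n ] (A * (⟦ S v ⟧ * indegree G v)) + ∑[ u < n ] (A * (⟦ not (S u) ⟧ * outdegree G u))
      ≤⟨ +-mono-≤ (∑-bound n into-small) (∑-mono-≤ out-of-large) ⟩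
    n * n + ∑[ u < n ] (n + A * n * ⟦ large A G u ⟧)
      ≡⟨ cong (n * n +_) (trans (∑-distrib-+ (λ _ → n) (λ u → A * n * ⟦ large A G u ⟧))
                                (cong₂ _+_ (∑-const n n) (sym (*-distribˡ-sum (A * n) (⟦_⟧ ∘ large A G))))) ⟩
    n * n + (n * n + A * n * size (large A G))
      ≡⟨ regroup (n * n) (A * n * size (large A G)) ⟩
    2 * (n * n) + A * n * size (large A G) ∎
    where
    open ≤-Reasoning
    regroup : ∀ a b → a + (a + b) ≡ 2 * a + b
    regroup = solve-∀
    S = not ∘ largeIn A G
    into-small : ∀ v → A * (⟦ S v ⟧ * indegree G v) ≤ n
    into-small v with n ≤? A * indegree G v
    ... | yes _     = ≤-trans (≤-reflexive (*-zeroʳ A)) z≤n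
    ... | no  small = ≤-trans (≤-reflexive (cong (A *_) (+-identityʳ _))) (<⇒≤ (≰⇒> small))
    out-of-large : ∀ u → A * (⟦ not (S u) ⟧ * outdegree G u) ≤ n + A * n * ⟦ large A G u ⟧
    out-of-large u with n ≤? A * indegree G u | n ≤? A * outdegree G u
    ... | no  _ | _         = ≤-trans (≤-reflexive (*-zeroʳ A)) z≤n
    ... | yes _ | no  small = ≤-trans (≤-reflexive (cong (A *_) (+-identityʳ _)))
                                      (≤-trans (<⇒≤ (≰⇒> small)) (m≤m+n n _))
    ... | yes _ | yes _     = begin
      A * (outdegree G u + 0) ≡⟨ cong (A *_) (+-identityʳ _) ⟩
      A * outdegree G u       ≤⟨ *-monoʳ-≤ A (size≤n (G u)) ⟩
      A * n                   ≡⟨ *-identityʳ (A * n) ⟨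
      A * n * 1               ≤⟨ m≤n+m _ n ⟩
      n + A * n * 1           ∎

  hamming : ∀ {n} → Digraph n → Digraph n → ℕ
  hamming {n} G H = ∑[ u < n ] ∑[ v < n ] ⟦ G u v xor H u v ⟧

  hamming+arcs : ∀ {n} (G H : Digraph n) → hamming G H + arcs G ≡ 2 * arcsNotIn G H + arcs H
  hamming+arcs {n} G H = begin
    hamming G H + arcs G
      ≡⟨ ∑²-distrib-+ (λ u v → ⟦ G u v xor H u v ⟧) (λ u v → ⟦ G u v ⟧) ⟨
    ∑[ u < n ] ∑[ v < n ] (⟦ G u v xor H u v ⟧ + ⟦ G u v ⟧)
      ≡⟨ sum-cong-≗ (λ u → sum-cong-≗ λ v → xor-count (G u v) (H u v)) ⟩
    ∑[ u < n ] ∑[ v < n ] (2 * ⟦ G u v ∧ not (H u v) ⟧ + ⟦ H u v ⟧)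
      ≡⟨ ∑²-distrib-+ (λ u v → 2 * ⟦ G u v ∧ not (H u v) ⟧) (λ u v → ⟦ H u v ⟧) ⟩
    ∑[ u < n ] ∑[ v < n ] (2 * ⟦ G u v ∧ not (H u v) ⟧) + arcs H
      ≡⟨ cong (_+ arcs H) (trans (sum-cong-≗ λ u → sym (*-distribˡ-sum 2 (misplaced u)))
                                  (sym (*-distribˡ-sum 2 (λ u → ∑[ v < n ] misplaced u v)))) ⟩
    2 * arcsNotIn G H + arcs H ∎
    where
    open ≡-Reasoning
    misplaced : Fin n → Fin n → ℕ
    misplaced u v = ⟦ G u v ∧ not (H u v) ⟧
    xor-count : ∀ a b → ⟦ a xor b ⟧ + ⟦ a ⟧ ≡ 2 * ⟦ a ∧ not b ⟧ + ⟦ b ⟧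
    xor-count true  true  = refl
    xor-count true  false = refl
    xor-count false true  = refl
    xor-count false false = refl

  arcs-antidirected : ∀ {n} (S : Fin n → Bool) → arcs (antidirected S) ≡ size S * size (not ∘ S)
  arcs-antidirected {n} S = begin
    ∑[ u < n ] ∑[ v < n ] ⟦ S u ∧ not (S v) ⟧
      ≡⟨ sum-cong-≗ (λ u → sum-cong-≗ λ v → ⟦∧⟧ (S u) (not (S v))) ⟩
    ∑[ u < n ] ∑[ v < n ] (⟦ S u ⟧ * ⟦ not (S v) ⟧)
      ≡⟨ sum-cong-≗ (λ u → *-distribˡ-sum ⟦ S u ⟧ (⟦_⟧ ∘ not ∘ S)) ⟨
    ∑[ u < n ] (⟦ S u ⟧ * size (not ∘ S))
      ≡⟨ *-distribʳ-sum (size (not ∘ S)) (⟦_⟧ ∘ S) ⟨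
    size S * size (not ∘ S) ∎
    where open ≡-Reasoning

  hamming-triangle : ∀ {n} (G H K : Digraph n) → hamming G K ≤ hamming G H + hamming H K
  hamming-triangle G H K =
    ≤-trans (∑²-mono-≤ λ u v → xor-triangle (G u v) (H u v) (K u v))
            (≤-reflexive (∑²-distrib-+ (λ u v → ⟦ G u v xor H u v ⟧) (λ u v → ⟦ H u v xor K u v ⟧)))
    where
    xor-triangle : ∀ a b c → ⟦ a xor c ⟧ ≤ ⟦ a xor b ⟧ + ⟦ b xor c ⟧
    xor-triangle true  true  c     = ≤-refl
    xor-triangle true  false true  = z≤n
    xor-triangle true  false false = ≤-refl
    xor-triangle false true  true  = ≤-refl
    xor-triangle false true  false = z≤n
    xor-triangle false false c     = ≤-refl

  diff : ∀ {n} → (Fin n → Bool) → (Fin n → Bool) → ℕ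
  diff S T = size (λ i → S i xor T i)

  hamming-antidirected : ∀ {n} (S T : Fin n → Bool) →
    hamming (antidirected S) (antidirected T) ≤ 2 * (n * diff S T)
  hamming-antidirected {n} S T = begin
    hamming (antidirected S) (antidirected T)
      ≤⟨ ∑²-mono-≤ (λ u v → moved-endpoint (S u) (S v) (T u) (T v)) ⟩
    ∑[ u < n ] ∑[ v < n ] (⟦ S u xor T u ⟧ + ⟦ S v xor T v ⟧)
      ≡⟨ ∑²-distrib-+ (λ u v → ⟦ S u xor T u ⟧) (λ u v → ⟦ S v xor T v ⟧) ⟩
    ∑[ u < n ] ∑[ v < n ] ⟦ S u xor T u ⟧ + ∑[ u < n ] diff S T
      ≡⟨ cong₂ _+_ (trans (sum-cong-≗ λ u → ∑-const n ⟦ S u xor T u ⟧)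
                          (sym (*-distribˡ-sum n (λ u → ⟦ S u xor T u ⟧))))
                   (∑-const n (diff S T)) ⟩
    n * diff S T + n * diff S T
      ≡⟨ cong (n * diff S T +_) (+-identityʳ (n * diff S T)) ⟨
    2 * (n * diff S T) ∎
    where
    open ≤-Reasoning
    moved-endpoint : ∀ a b c d → ⟦ (a ∧ not b) xor (c ∧ not d) ⟧ ≤ ⟦ a xor c ⟧ + ⟦ b xor d ⟧
    moved-endpoint false b     true  d     = ≤-trans (⟦⟧≤1 (not d)) (m≤m+n 1 _)
    moved-endpoint false b     false d     = z≤n
    moved-endpoint true  true  true  d     = ≤-refl
    moved-endpoint true  true  false d     = z≤n
    moved-endpoint true  false false d     = m≤m+n 1 _
    moved-endpoint true  false true  true  = ≤-refl
    moved-endpoint true  false true  false = z≤n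

  editDistance≤hamming : ∀ {n} (G H : Digraph n) → editDistance G H ≤ hamming G H
  editDistance≤hamming {n} G H = begin
    editDistance G H
      ≡⟨ trans (ΣFin≡∑ n _) (sum-cong-≗ λ u → ΣFin≡∑ n λ v → ⟦ (u <ᶠ v) ∧ (d u v ∨ d v u) ⟧) ⟩
    ∑[ u < n ] ∑[ v < n ] ⟦ (u <ᶠ v) ∧ (d u v ∨ d v u) ⟧
      ≤⟨ ∑²-mono-≤ (λ u v → ⟦∧∨⟧≤ (u <ᶠ v) (d u v) (d v u)) ⟩
    ∑[ u < n ] ∑[ v < n ] (forward u v + backward v u)
      ≡⟨ ∑²-distrib-+ forward (λ u v → backward v u) ⟩
    ∑[ u < n ] ∑[ v < n ] forward u v + ∑[ u < n ] ∑[ v < n ] backward v u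
      ≡⟨ cong (∑[ u < n ] ∑[ v < n ] forward u v +_) (∑-comm (λ u v → backward v u)) ⟩
    ∑[ u < n ] ∑[ v < n ] forward u v + ∑[ v < n ] ∑[ u < n ] backward v u
      ≡⟨ ∑²-distrib-+ forward backward ⟨
    ∑[ u < n ] ∑[ v < n ] (forward u v + backward u v)
      ≤⟨ ∑²-mono-≤ (λ u v → at-most-one-order (toℕ u) (toℕ v) (d u v)) ⟩
    ∑[ u < n ] ∑[ v < n ] ⟦ d u v ⟧
      ≡⟨ sum-cong-≗ (λ u → sum-cong-≗ λ v → cong ⟦_⟧ (differs≡xor (G u v) (H u v))) ⟩
    hamming G H ∎
    where
    open ≤-Reasoning
    _<ᶠ_ : Fin n → Fin n → Bool
    u <ᶠ v = toℕ u <ᵇ toℕ v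
    d : Fin n → Fin n → Bool
    d u v = not ⌊ G u v ≟ᵇ H u v ⌋
    forward backward : Fin n → Fin n → ℕ
    forward  u v = ⟦ u <ᶠ v ⟧ * ⟦ d u v ⟧
    backward u v = ⟦ v <ᶠ u ⟧ * ⟦ d u v ⟧
    ⟦∧∨⟧≤ : ∀ a b c → ⟦ a ∧ (b ∨ c) ⟧ ≤ ⟦ a ⟧ * ⟦ b ⟧ + ⟦ a ⟧ * ⟦ c ⟧
    ⟦∧∨⟧≤ false b     c     = z≤n
    ⟦∧∨⟧≤ true  true  c     = s≤s z≤n
    ⟦∧∨⟧≤ true  false true  = ≤-refl
    ⟦∧∨⟧≤ true  false false = z≤n
    at-most-one-order : ∀ i j b → ⟦ i <ᵇ j ⟧ * ⟦ b ⟧ + ⟦ j <ᵇ i ⟧ * ⟦ b ⟧ ≤ ⟦ b ⟧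
    at-most-one-order zero    zero    b = z≤n
    at-most-one-order zero    (suc j) b = ≤-reflexive (trans (+-identityʳ _) (+-identityʳ ⟦ b ⟧))
    at-most-one-order (suc i) zero    b = ≤-reflexive (+-identityʳ ⟦ b ⟧)
    at-most-one-order (suc i) (suc j) b = at-most-one-order i j b
    differs≡xor : ∀ a b → not ⌊ a ≟ᵇ b ⌋ ≡ a xor b
    differs≡xor true  true  = refl
    differs≡xor true  false = refl
    differs≡xor false true  = refl
    differs≡xor false false = refl

  resize : ∀ {n} (S : Fin n → Bool) b → b ≤ n →
    Σ (Fin n → Bool) λ S′ → size S′ ≡ b × diff S S′ ≤ ∣ size S - b ∣
  resize {zero}  S zero _      = S , refl , z≤n
  resize {suc n} S b    b≤1+n = resize-∷ (S Fin.zero) b b≤1+n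
    where
    R = S ∘ Fin.suc
    resize-∷ : ∀ x b → b ≤ suc n →
      Σ (Fin (suc n) → Bool) λ S′ → size S′ ≡ b × diff (x ∷ R) S′ ≤ ∣ ⟦ x ⟧ + size R - b ∣
    resize-∷ true zero _ with resize R zero z≤n
    ... | T , |T|≡0 , diff≤ =
      false ∷ T , |T|≡0 , s≤s (≤-trans diff≤ (≤-reflexive (∣-∣-identityʳ (size R))))
    resize-∷ true (suc b) b<1+n with resize R b (≤-pred b<1+n)
    ... | T , |T|≡b , diff≤ = true ∷ T , cong suc |T|≡b , diff≤
    resize-∷ false b b≤1+n with m≤n⇒m<n∨m≡n b≤1+n
    ... | inj₁ b<1+n with resize R b (≤-pred b<1+n)
    ...   | T , |T|≡b , diff≤ = false ∷ T , |T|≡b , diff≤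
    resize-∷ false .(suc n) _ | inj₂ refl with resize R n ≤-refl
    ...   | T , |T|≡n , diff≤ = true ∷ T , cong suc |T|≡n , (begin
      suc (diff R T)      ≤⟨ s≤s diff≤ ⟩
      suc ∣ size R - n ∣  ≡⟨ cong suc (m≤n⇒∣m-n∣≡n∸m (size≤n R)) ⟩
      suc (n ∸ size R)    ≡⟨ +-∸-assoc 1 (size≤n R) ⟨
      suc n ∸ size R      ≡⟨ m≤n⇒∣m-n∣≡n∸m (m≤n⇒m≤1+n (size≤n R)) ⟨
      ∣ size R - suc n ∣  ∎)
      where open ≤-Reasoning

  ⌈n/2⌉≤1+⌊n/2⌋ : ∀ n → ⌈ n /2⌉ ≤ suc ⌊ n /2⌋
  ⌈n/2⌉≤1+⌊n/2⌋ zero          = z≤n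
  ⌈n/2⌉≤1+⌊n/2⌋ (suc zero)    = ≤-refl
  ⌈n/2⌉≤1+⌊n/2⌋ (suc (suc n)) = s≤s (⌈n/2⌉≤1+⌊n/2⌋ n)

  distance-to-half : ∀ s r → 2 * ∣ s - ⌊ (s + r) /2⌋ ∣ ≤ ∣ s - r ∣ + 1
  distance-to-half s r = begin
    2 * ∣ s - h ∣                 ≡⟨ *-distribˡ-∣-∣ 2 s h ⟩
    ∣ 2 * s - 2 * h ∣             ≤⟨ ∣-∣-triangle (2 * s) (s + r) (2 * h) ⟩
    ∣ 2 * s - s + r ∣ + ∣ s + r - 2 * h ∣ ≡⟨ cong₂ _+_ 2s-n n-2h ⟩
    ∣ s - r ∣ + ∣ c - h ∣         ≤⟨ +-monoʳ-≤ ∣ s - r ∣ c-h≤1 ⟩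
    ∣ s - r ∣ + 1                 ∎
    where
    open ≤-Reasoning
    h = ⌊ (s + r) /2⌋
    c = ⌈ (s + r) /2⌉
    2s-n : ∣ 2 * s - s + r ∣ ≡ ∣ s - r ∣
    2s-n = trans (cong (λ x → ∣ s + x - s + r ∣) (+-identityʳ s)) (∣m+n-m+o∣≡∣n-o∣ s s r)
    n-2h : ∣ s + r - 2 * h ∣ ≡ ∣ c - h ∣
    n-2h = trans (cong₂ ∣_-_∣ (sym (⌊n/2⌋+⌈n/2⌉≡n (s + r))) (cong (h +_) (+-identityʳ h)))
                 (∣m+n-m+o∣≡∣n-o∣ h c h)
    c-h≤1 : ∣ c - h ∣ ≤ 1
    c-h≤1 = begin
      ∣ c - h ∣ ≡⟨ trans (∣-∣-comm c h) (m≤n⇒∣m-n∣≡n∸m (⌊n/2⌋≤⌈n/2⌉ (s + r))) ⟩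
      c ∸ h     ≤⟨ ∸-monoˡ-≤ h (⌈n/2⌉≤1+⌊n/2⌋ (s + r)) ⟩
      suc h ∸ h ≡⟨ m+n∸n≡m 1 h ⟩
      1         ∎

  balance : ∀ {n} (S : Fin n → Bool) →
    Σ (Fin n → Bool) λ S′ → BalancedSide S′ × 2 * diff S S′ ≤ ∣ size S - size (not ∘ S) ∣ + 1
  balance {n} S with resize S ⌊ n /2⌋ (⌊n/2⌋≤n n)
  ... | S′ , |S′|≡⌊n/2⌋ , diff≤ = S′ , inj₁ (trans (setSize≡size S′) |S′|≡⌊n/2⌋) , (begin
    2 * diff S S′             ≤⟨ *-monoʳ-≤ 2 diff≤ ⟩
    2 * ∣ s - ⌊ n /2⌋ ∣       ≡⟨ cong (λ m → 2 * ∣ s - ⌊ m /2⌋ ∣) (size+size-not S) ⟨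
    2 * ∣ s - ⌊ (s + r) /2⌋ ∣ ≤⟨ distance-to-half s r ⟩
    ∣ s - r ∣ + 1             ∎)
    where
    open ≤-Reasoning
    s = size S
    r = size (not ∘ S)

  square-of-sum-≤ : ∀ s r → s ≤ r → (s + r) * (s + r) ≡ 4 * (s * r) + ∣ s - r ∣ * ∣ s - r ∣
  square-of-sum-≤ s r s≤r with m≤n⇒∃[o]m+o≡n s≤r
  ... | d , refl =
    trans (expand s d) (cong (λ x → 4 * (s * (s + d)) + x * x) (sym (∣m-m+n∣≡n s d)))
    where
    expand : ∀ s d → (s + (s + d)) * (s + (s + d)) ≡ 4 * (s * (s + d)) + d * d
    expand = solve-∀

  square-of-sum : ∀ s r → (s + r) * (s + r) ≡ 4 * (s * r) + ∣ s - r ∣ * ∣ s - r ∣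
  square-of-sum s r with ≤-total s r
  ... | inj₁ s≤r = square-of-sum-≤ s r s≤r
  ... | inj₂ r≤s = begin
    (s + r) * (s + r)                     ≡⟨ cong (λ x → x * x) (+-comm s r) ⟩
    (r + s) * (r + s)                     ≡⟨ square-of-sum-≤ r s r≤s ⟩
    4 * (r * s) + ∣ r - s ∣ * ∣ r - s ∣   ≡⟨ cong₂ (λ x y → 4 * x + y * y) (*-comm r s) (∣-∣-comm r s) ⟩
    4 * (s * r) + ∣ s - r ∣ * ∣ s - r ∣   ∎
    where open ≡-Reasoning

  -- Read m = n², e = arcs of G, b = its arcs outside S → Sᶜ, D = its distance to S → Sᶜ,
  -- p = |S||Sᶜ| and u = ||S| − |Sᶜ||.
  deficit-bound : ∀ {A e b D p u m} → A * m ≤ 4 * A * e + 4 * m → A * b ≤ 3 * m →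
    D + e ≡ 2 * b + p → m ≡ 4 * p + u * u → A * (4 * D + u * u) ≤ 28 * m
  deficit-bound {A} {e} {b} {D} {p} {u} {m} dense few-misplaced D+e≡ m≡ =
    +-cancelʳ-≤ (4 * A * e) _ _ (begin
    A * (4 * D + u * u) + 4 * A * e    ≡⟨ regroup A D u e ⟩
    4 * A * (D + e) + A * (u * u)      ≡⟨ cong (λ x → 4 * A * x + A * (u * u)) D+e≡ ⟩
    4 * A * (2 * b + p) + A * (u * u)  ≡⟨ regroup′ A b p u ⟩
    8 * (A * b) + A * (4 * p + u * u)  ≡⟨ cong (λ x → 8 * (A * b) + A * x) m≡ ⟨
    8 * (A * b) + A * m                ≤⟨ +-mono-≤ (*-monoʳ-≤ 8 few-misplaced) dense ⟩
    8 * (3 * m) + (4 * A * e + 4 * m)  ≡⟨ regroup″ m A e ⟩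
    28 * m + 4 * A * e                 ∎)
    where
    open ≤-Reasoning
    regroup : ∀ A D u e → A * (4 * D + u * u) + 4 * A * e ≡ 4 * A * (D + e) + A * (u * u)
    regroup = solve-∀
    regroup′ : ∀ A b p u → 4 * A * (2 * b + p) + A * (u * u) ≡ 8 * (A * b) + A * (4 * p + u * u)
    regroup′ = solve-∀
    regroup″ : ∀ m A e → 8 * (3 * m) + (4 * A * e + 4 * m) ≡ 28 * m + 4 * A * e
    regroup″ = solve-∀

  m*m≤n*n⇒m≤n : ∀ {m n} → m * m ≤ n * n → m ≤ n
  m*m≤n*n⇒m≤n m*m≤n*n = ≮⇒≥ λ n<m → <⇒≱ (*-mono-< n<m n<m) m*m≤n*n

  -- With R = 3Q the hypothesis on A gives R²(4D + u²) ≤ n², so each of the three terms of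
  -- R·(D + n u + n) is at most n².
  error-bound : ∀ {A Q D u n ed} .{{_ : NonZero Q}} → A * (4 * D + u * u) ≤ 28 * (n * n) →
    252 * (Q * Q) ≤ A → 3 * Q ≤ n → ed ≤ D + n * (u + 1) → Q * ed ≤ n * n
  error-bound {A} {Q} {D} {u} {n} {ed} deficit A-large R≤n ed≤ = *-cancelˡ-≤ 3 (begin
    3 * (Q * ed)               ≡⟨ *-assoc 3 Q ed ⟨
    R * ed                     ≤⟨ *-monoʳ-≤ R ed≤ ⟩
    R * (D + n * (u + 1))      ≡⟨ expand R D n u ⟩
    R * D + n * (R * u) + R * n
      ≤⟨ +-mono-≤ (+-mono-≤ R*D≤n*n (*-monoʳ-≤ n R*u≤n)) (*-monoˡ-≤ n R≤n) ⟩
    n * n + n * n + n * n      ≡⟨ triple (n * n) ⟩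
    3 * (n * n)                ∎)
    where
    open ≤-Reasoning
    R = 3 * Q
    X = 4 * D + u * u
    R*R*X≤n*n : R * R * X ≤ n * n
    R*R*X≤n*n = *-cancelˡ-≤ 28 (begin
      28 * (R * R * X)   ≡⟨ regroup Q X ⟩
      252 * (Q * Q) * X  ≤⟨ *-monoˡ-≤ X A-large ⟩
      A * X              ≤⟨ deficit ⟩
      28 * (n * n)       ∎)
      where
      regroup : ∀ Q X → 28 * (3 * Q * (3 * Q) * X) ≡ 252 * (Q * Q) * X
      regroup = solve-∀
    1≤R : 1 ≤ R
    1≤R = ≤-trans (>-nonZero⁻¹ Q) (m≤m+n Q _)
    R*D≤n*n : R * D ≤ n * n
    R*D≤n*n = begin
      R * D              ≡⟨ cong (_* D) (*-identityʳ R) ⟨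
      R * 1 * D          ≤⟨ *-mono-≤ (*-monoʳ-≤ R 1≤R) (≤-trans (m≤m+n D (3 * D)) (m≤m+n (4 * D) (u * u))) ⟩
      R * R * X          ≤⟨ R*R*X≤n*n ⟩
      n * n              ∎
    R*u≤n : R * u ≤ n
    R*u≤n = m*m≤n*n⇒m≤n (begin
      R * u * (R * u)    ≡⟨ regroup R u ⟩
      R * R * (u * u)    ≤⟨ *-monoʳ-≤ (R * R) (m≤n+m (u * u) (4 * D)) ⟩
      R * R * X          ≤⟨ R*R*X≤n*n ⟩
      n * n              ∎)
      where
      regroup : ∀ R u → R * u * (R * u) ≡ R * R * (u * u)
      regroup = solve-∀
    expand : ∀ R D n u → R * (D + n * (u + 1)) ≡ R * D + n * (R * u) + R * n
    expand = solve-∀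
    triple : ∀ m → m + m + m ≡ 3 * m
    triple = solve-∀

  nearly-antidirected : ∀ {n} t A .{{_ : NonZero A}} → 1 ≤ t →
    A * (t * ((2 * A) ^ t * (2 * A) ^ t)) ≤ n → 2 * A * t ≤ n →
    (G : Digraph n) → IsOriented G → ¬ ContainsP3Blowup t G →
    A * (n * n) ≤ 4 * A * arcCount G + 4 * (n * n) →
    let S = not ∘ largeIn A G; u = ∣ size S - size (not ∘ S) ∣ in
    A * (4 * hamming G (antidirected S) + u * u) ≤ 28 * (n * n)
  nearly-antidirected {n} t A t≥1 A*K≤n 2At≤n G oriented P3-free dense =
    deficit-bound {A} {arcs G} {arcsNotIn G H} {hamming G H} {size S * size (not ∘ S)} {u} {n * n}
      (subst (λ e → A * (n * n) ≤ 4 * A * e + 4 * (n * n)) (arcCount≡arcs G) dense)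
      few-misplaced
      (trans (hamming+arcs G H) (cong (2 * arcsNotIn G H +_) (arcs-antidirected S)))
      (trans (cong (λ m → m * m) (sym (size+size-not S))) (square-of-sum (size S) (size (not ∘ S))))
    where
    open ≤-Reasoning
    S = not ∘ largeIn A G
    H = antidirected S
    u = ∣ size S - size (not ∘ S) ∣
    few-large : A * size (large A G) ≤ n
    few-large = ≤-trans (*-monoʳ-≤ A (<⇒≤ (≰⇒> (P3-free ∘ large⇒P3Blowup G oriented A t t≥1 2At≤n))))
                        A*K≤n
    few-misplaced : A * arcsNotIn G H ≤ 3 * (n * n)
    few-misplaced = begin
      A * arcsNotIn G H                         ≤⟨ arcsNotIn-bound A G ⟩
      2 * (n * n) + A * n * size (large A G)    ≡⟨ cong (2 * (n * n) +_) (regroup A n _) ⟩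
      2 * (n * n) + n * (A * size (large A G))  ≤⟨ +-monoʳ-≤ (2 * (n * n)) (*-monoʳ-≤ n few-large) ⟩
      2 * (n * n) + n * n                       ≡⟨ +-comm (2 * (n * n)) (n * n) ⟩
      3 * (n * n)                               ∎
      where
      regroup : ∀ a b c → a * b * c ≡ b * (a * c)
      regroup = solve-∀

  -- The summands give A·K ≤ n for K = t(2A)^{2t}, so that the fewer than K vertices of large
  -- in- and out-degree are negligible, 2At ≤ n for the fans, and 3Q ≤ n.
  threshold : ℕ → ℕ → ℕ → ℕ
  threshold t A Q = A * (t * ((2 * A) ^ t * (2 * A) ^ t)) + 2 * A * t + 3 * Q

  stability : ∀ {n} t A Q .{{_ : NonZero A}} .{{_ : NonZero Q}} → 1 ≤ t → 252 * (Q * Q) ≤ A →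
    threshold t A Q ≤ n → (G : Digraph n) → IsOriented G → ¬ ContainsP3Blowup t G →
    A * (n * n) ≤ 4 * A * arcCount G + 4 * (n * n) →
    Σ (Fin n → Bool) λ S′ → BalancedSide S′ × Q * editDistance G (antidirected S′) ≤ n * n
  stability {n} t A Q t≥1 A-large n-large G oriented P3-free dense =
    let S′ , balanced , 2diff≤ = balance S in
    S′ , balanced , error-bound {A} {Q} {hamming G H} {u} {n}
      (nearly-antidirected t A t≥1 A*K≤n 2At≤n G oriented P3-free dense) A-large 3Q≤n (begin
      editDistance G (antidirected S′)          ≤⟨ editDistance≤hamming G (antidirected S′) ⟩
      hamming G (antidirected S′)               ≤⟨ hamming-triangle G H (antidirected S′) ⟩
      hamming G H + hamming H (antidirected S′) ≤⟨ +-monoʳ-≤ (hamming G H) (hamming-antidirected S S′) ⟩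
      hamming G H + 2 * (n * diff S S′)         ≡⟨ cong (hamming G H +_) (*-left-comm 2 n (diff S S′)) ⟩
      hamming G H + n * (2 * diff S S′)         ≤⟨ +-monoʳ-≤ (hamming G H) (*-monoʳ-≤ n 2diff≤) ⟩
      hamming G H + n * (u + 1)                 ∎)
    where
    open ≤-Reasoning
    *-left-comm : ∀ a b c → a * (b * c) ≡ b * (a * c)
    *-left-comm = solve-∀
    S = not ∘ largeIn A G
    H = antidirected S
    u = ∣ size S - size (not ∘ S) ∣
    K = t * ((2 * A) ^ t * (2 * A) ^ t)
    A*K≤n : A * K ≤ n
    A*K≤n = ≤-trans (≤-trans (m≤m+n (A * K) (2 * A * t)) (m≤m+n _ (3 * Q))) n-large
    2At≤n : 2 * A * t ≤ n
    2At≤n = ≤-trans (≤-trans (m≤n+m (2 * A * t) (A * K)) (m≤m+n _ (3 * Q))) n-large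
    3Q≤n : 3 * Q ≤ n
    3Q≤n = ≤-trans (m≤n+m (3 * Q) (A * K + 2 * A * t)) n-large

module RationalBounds where
  open import Data.Nat as ℕ using (ℕ; suc)
  import Data.Nat.Properties as ℕ
  open import Data.Integer as ℤ using (+_; -[1+_]; +≤+; +<+)
  import Data.Integer.Properties as ℤ
  open import Data.Integer.Tactic.RingSolver using (solve-∀)
  open import Data.Rational using (mkℚ; 0ℚ; _<_; _≤_; _*_; _-_; _/_; -_; toℚᵘ; *<*)
  import Data.Rational.Properties as ℚ
  open import Data.Rational.Unnormalised as ℚᵘ using (mkℚᵘ; *≤*; _≃_)
  import Data.Rational.Unnormalised.Properties as ℚᵘ
  open import Data.Product using (Σ; _,_)
  open import Relation.Binary.PropositionalEquality

  toℚᵘ-/ : ∀ z d → toℚᵘ (z / suc d) ≃ mkℚᵘ z d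
  toℚᵘ-/ z d = ℚ.toℚᵘ-fromℚᵘ (mkℚᵘ z d)

  1/[1+a]>0 : ∀ a → 0ℚ < + 1 / suc a
  1/[1+a]>0 a = ℚ.positive⁻¹ (+ 1 / suc a) {{ℚ.normalize-pos 1 (suc a)}}

  toℚᵘ-m/4-m/[1+a] : ∀ m a → toℚᵘ ((+ m) / 4 - (+ 1 / suc a) * ((+ m) / 1)) ≃
    mkℚᵘ (+ m) 3 ℚᵘ.- mkℚᵘ (+ 1) a ℚᵘ.* mkℚᵘ (+ m) 0
  toℚᵘ-m/4-m/[1+a] m a = ℚᵘ.≃-trans (ℚ.toℚᵘ-homo-+ ((+ m) / 4) (- (δ * ((+ m) / 1))))
    (ℚᵘ.+-cong (toℚᵘ-/ (+ m) 3) (ℚᵘ.≃-trans (ℚ.toℚᵘ-homo‿- (δ * ((+ m) / 1))) (ℚᵘ.-‿cong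
      (ℚᵘ.≃-trans (ℚ.toℚᵘ-homo-* δ ((+ m) / 1)) (ℚᵘ.*-cong (toℚᵘ-/ (+ 1) a) (toℚᵘ-/ (+ m) 0))))))
    where δ = + 1 / suc a

  m/4-m/[1+a]≤e⇒ : ∀ m a e → (+ m) / 4 - (+ 1 / suc a) * ((+ m) / 1) ≤ (+ e) / 1 →
    suc a ℕ.* m ℕ.≤ 4 ℕ.* suc a ℕ.* e ℕ.+ 4 ℕ.* m
  m/4-m/[1+a]≤e⇒ m a e le
    with ℚᵘ.≤-respˡ-≃ (toℚᵘ-m/4-m/[1+a] m a) (ℚᵘ.≤-respʳ-≃ (toℚᵘ-/ (+ e) 0) (ℚ.toℚᵘ-mono-≤ le))
  ... | *≤* cross = ℤ.drop‿+≤+ (subst₂ ℤ._≤_ lhs rhs (ℤ.+-monoˡ-≤ ((+ 4) ℤ.* (+ m)) cross))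
    where
    b = suc (a ℕ.* 1)
    b≡1+a : b ≡ suc a
    b≡1+a = cong suc (ℕ.*-identityʳ a)
    cancel : ∀ x y → (x ℤ.* y ℤ.+ (ℤ.- ((+ 1) ℤ.* x)) ℤ.* (+ 4)) ℤ.* (+ 1) ℤ.+ (+ 4) ℤ.* x ≡ y ℤ.* x
    cancel = solve-∀
    commute : ∀ x y z → x ℤ.* ((+ 4) ℤ.* y) ℤ.+ (+ 4) ℤ.* z ≡ (+ 4) ℤ.* y ℤ.* x ℤ.+ (+ 4) ℤ.* z
    commute = solve-∀
    lhs : ((+ m) ℤ.* (+ b) ℤ.+ (ℤ.- ((+ 1) ℤ.* (+ m))) ℤ.* (+ 4)) ℤ.* (+ 1) ℤ.+ (+ 4) ℤ.* (+ m) ≡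
          + (suc a ℕ.* m)
    lhs = trans (cancel (+ m) (+ b)) (trans (sym (ℤ.pos-* b m)) (cong (λ c → + (c ℕ.* m)) b≡1+a))
    rhs : (+ e) ℤ.* (+ (4 ℕ.* b)) ℤ.+ (+ 4) ℤ.* (+ m) ≡ + (4 ℕ.* suc a ℕ.* e ℕ.+ 4 ℕ.* m)
    rhs = begin
      (+ e) ℤ.* (+ (4 ℕ.* b)) ℤ.+ (+ 4) ℤ.* (+ m)
        ≡⟨ cong (λ c → (+ e) ℤ.* c ℤ.+ (+ 4) ℤ.* (+ m)) (ℤ.pos-* 4 b) ⟩
      (+ e) ℤ.* ((+ 4) ℤ.* (+ b)) ℤ.+ (+ 4) ℤ.* (+ m)
        ≡⟨ commute (+ e) (+ b) (+ m) ⟩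
      (+ 4) ℤ.* (+ b) ℤ.* (+ e) ℤ.+ (+ 4) ℤ.* (+ m)
        ≡⟨ cong₂ ℤ._+_ (trans (cong (ℤ._* (+ e)) (sym (ℤ.pos-* 4 b))) (sym (ℤ.pos-* (4 ℕ.* b) e)))
                       (sym (ℤ.pos-* 4 m)) ⟩
      + (4 ℕ.* b ℕ.* e) ℤ.+ + (4 ℕ.* m)
        ≡⟨ sym (ℤ.pos-+ (4 ℕ.* b ℕ.* e) (4 ℕ.* m)) ⟩
      + (4 ℕ.* b ℕ.* e ℕ.+ 4 ℕ.* m)
        ≡⟨ cong (λ c → + (4 ℕ.* c ℕ.* e ℕ.+ 4 ℕ.* m)) b≡1+a ⟩
      + (4 ℕ.* suc a ℕ.* e ℕ.+ 4 ℕ.* m) ∎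
      where open ≡-Reasoning

  archimedean : ∀ ε → 0ℚ < ε → Σ ℕ λ q → ∀ m k → suc q ℕ.* m ℕ.≤ k → (+ m) / 1 ≤ ε * ((+ k) / 1)
  archimedean (mkℚ (+ 0)    _ _) (*<* (+<+ ()))
  archimedean (mkℚ -[1+ _ ] _ _) (*<* ())
  archimedean ε@(mkℚ (+ suc p) d _) _ = d , λ m k le →
    ℚ.toℚᵘ-cancel-≤ (ℚᵘ.≤-respˡ-≃ (ℚᵘ.≃-sym (toℚᵘ-/ (+ m) 0))
                      (ℚᵘ.≤-respʳ-≃ (ℚᵘ.≃-sym (toℚᵘ-ε*k k)) (*≤* (cross m k le))))
    where
    toℚᵘ-ε*k : ∀ k → toℚᵘ (ε * ((+ k) / 1)) ≃ mkℚᵘ (+ suc p) d ℚᵘ.* mkℚᵘ (+ k) 0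
    toℚᵘ-ε*k k = ℚᵘ.≃-trans (ℚ.toℚᵘ-homo-* ε ((+ k) / 1)) (ℚᵘ.*-congˡ {mkℚᵘ (+ suc p) d} (toℚᵘ-/ (+ k) 0))
    cross : ∀ m k → suc d ℕ.* m ℕ.≤ k → (+ m) ℤ.* (+ (suc d ℕ.* 1)) ℤ.≤ ((+ suc p) ℤ.* (+ k)) ℤ.* (+ 1)
    cross m k le = subst₂ ℤ._≤_ (ℤ.pos-* m (suc d ℕ.* 1))
                               (trans (ℤ.pos-* (suc p ℕ.* k) 1) (cong (ℤ._* + 1) (ℤ.pos-* (suc p) k)))
                               (+≤+ (begin
      m ℕ.* (suc d ℕ.* 1)   ≡⟨ cong (m ℕ.*_) (ℕ.*-identityʳ (suc d)) ⟩
      m ℕ.* suc d           ≡⟨ ℕ.*-comm m (suc d) ⟩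
      suc d ℕ.* m           ≤⟨ le ⟩
      k                     ≤⟨ ℕ.m≤m+n k (p ℕ.* k) ⟩
      suc p ℕ.* k           ≡⟨ ℕ.*-identityʳ (suc p ℕ.* k) ⟨
      suc p ℕ.* k ℕ.* 1     ∎))
      where open ℕ.≤-Reasoning

open import Defs
open import Data.Nat as ℕ using (ℕ; _≥_)
open import Data.Integer using (+_)
open import Data.Rational using (ℚ; 0ℚ; _<_; _≤_; _*_; _-_; _/_)
open import Data.Product using (Σ; _×_; _,_)
open import Data.Bool using (Bool)
open import Data.Fin using (Fin)
open import Relation.Nullary using (¬_)
open import Data.Nat.Properties using (n≤1+n)
open Stability using (threshold; stability)
open RationalBounds using (1/[1+a]>0; m/4-m/[1+a]≤e⇒; archimedean)

theorem3p1 : (t : ℕ) → t ≥ 1 →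
    (ε : ℚ) → 0ℚ < ε →
    Σ ℚ λ δ → 0ℚ < δ × Σ ℕ λ n₀ →
      (n : ℕ) → n ≥ n₀ → (G : Digraph n) → IsOriented G →
      ¬ ContainsP3Blowup t G →
      (+ (n ℕ.* n)) / 4 - δ * ((+ (n ℕ.* n)) / 1) ≤ (+ arcCount G) / 1 →
      Σ (Fin n → Bool) λ S → BalancedSide S ×
        (+ editDistance G (antidirected S)) / 1 ≤ ε * ((+ (n ℕ.* n)) / 1)
theorem3p1 t t≥1 ε ε>0 with archimedean ε ε>0
... | q , below-ε = + 1 / A , 1/[1+a]>0 a , threshold t A Q , λ n n≥n₀ G oriented P3-free dense →
  let S , balanced , Q*ed≤n² = stability t A Q t≥1 (n≤1+n a) n≥n₀ G oriented P3-free
                                 (m/4-m/[1+a]≤e⇒ (n ℕ.* n) a (arcCount G) dense)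
  in S , balanced , below-ε _ _ Q*ed≤n²
  where
  Q = ℕ.suc q
  a = 252 ℕ.* (Q ℕ.* Q)
  A = ℕ.suc a
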